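{- For every integer $n \geq 1$, $\operatorname{diam}(\mathcal{R}_n) > n - \sqrt{2n}$.
   Context: A binary string is called run-constrained if every run (maximal block) of consecutive $1$s in it is immediately followed by a run of $0$s of strictly greater length. For $n \geq 1$, the Fibonacci-run graph $\mathcal{R}_n$ has vertex set $\{ w \in \{0,1\}^n : w00 \text{ is a run-constrained string of length } n+2\}$, and two vertices are adjacent iff they differ in exactly one coordinate. $\operatorname{diam}(G)$ is the maximum graph distance between two vertices of $G$. -}

module Defs where

open import Data.Bool using (Bool; true; false)
open import Data.Nat using (ℕ; zero; suc; _≤_; _<_)
open import Data.List using (List; []; _∷_; _++_; replicate)
open import Data.Vec using (Vec; lookup; toList)
open import Data.Fin using (Fin)
open import Data.Product using (Σ; _×_; ∃)
open import Relation.Binary.PropositionalEquality using (_≡_; _≢_)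

-- Binary strings: true = 1, false = 0.

-- Run-constrained strings: every maximal run of 1s is immediately followed
-- by a run of 0s of strictly greater length.  Grammar:
--   * the empty string;
--   * a 0 followed by a run-constrained string;
--   * 1^i 0^j followed by a run-constrained string, with 1 ≤ i < j.
-- (The run of 1s is maximal since it is preceded by nothing or by a 0 and
--  followed by a 0; the following 0-run has length ≥ j > i.)
data RunConstrained : List Bool → Set where
  rc-nil   : RunConstrained []
  rc-zero  : ∀ {xs} → RunConstrained xs → RunConstrained (false ∷ xs)
  rc-block : ∀ {rest} (i j : ℕ) → 1 ≤ i → i < j → RunConstrained rest →
             RunConstrained (replicate i true ++ (replicate j false ++ rest))

Word : ℕ → Set
Word n = Vec Bool n

IsVertex : (n : ℕ) → Word n → Set
IsVertex n w = RunConstrained (toList w ++ (false ∷ false ∷ []))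

Adjacent : (n : ℕ) → Word n → Word n → Set
Adjacent n u v =
  Σ (Fin n) λ i → (lookup u i ≢ lookup v i) ×
                   (∀ j → j ≢ i → lookup u j ≡ lookup v j)

-- Walk u v k : a walk of length k from u to v in R_n, all of whose vertices
-- after u are vertices of R_n (u itself is required to be a vertex separately).
data Walk (n : ℕ) : Word n → Word n → ℕ → Set where
  walk-here : ∀ {u} → Walk n u u 0
  walk-step : ∀ {u v w k} → IsVertex n v → Adjacent n u v →
              Walk n v w k → Walk n u w (suc k)

Dist : (n : ℕ) → Word n → Word n → ℕ → Set
Dist n u v k = Walk n u v k × (∀ m → Walk n u v m → k ≤ m)

IsDiameter : (n : ℕ) → ℕ → Set
IsDiameter n d =
  (∃ λ u → ∃ λ v → IsVertex n u × IsVertex n v × Dist n u v d) ×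
  (∀ u v → IsVertex n u → IsVertex n v → ∃ λ k → Dist n u v k × k ≤ d)

-- Clearing the leftmost 1 of a vertex gives a vertex, so R_n is connected
-- and, being finite, has a diameter; it is at least the Hamming distance
-- between any two vertices.
--
-- Take a strictly increasing sequence l₁ < l₂ < ⋯ < l_k < t + 2 and let u and
-- v be the words made of alternating blocks of lengths l₁, …, l_k, starting
-- with 1 resp. 0, padded with t zeros.  Every run of 1s is followed by a
-- strictly longer run of 0s (the padding plus the appended 00 for the last
-- one), so u and v are vertices, at Hamming distance Σ lᵢ = n − t.  Writing
-- n = S + t with S ≤ 1 + 2 + ⋯ + (t + 1), which is possible with t² < 2n,
-- and splitting S into distinct parts at most t + 1 gives n − diam ≤ t.
module Submission where

open import Defs
open import Data.Nat using (ℕ; _≤_; _<_; _*_; _∸_)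
open import Data.Product using (∃; _×_)

open import Data.Bool using (Bool; true; false; not; _xor_; if_then_else_)
open import Data.Bool.Properties using () renaming (_≟_ to _≟ᵇ_)
open import Data.Empty using (⊥-elim)
open import Data.Fin using () renaming (zero to fzero; suc to fsuc)
open import Data.Fin.Properties using (any?; all?) renaming (_≟_ to _≟ᶠ_; suc-injective to fsuc-injective)
open import Data.List using (List; []; _∷_; _++_; _∷ʳ_; replicate; length)
open import Data.List.Properties using (++-assoc; ++-identityʳ; length-++; length-replicate)
open import Data.Nat.ListAction using (sum)
open import Data.Nat.ListAction.Properties using (sum-++)
open import Data.List.Relation.Unary.Linked as Linked using (Linked; [-]; _∷_)
open import Data.Nat using (zero; suc; _+_; z≤n; s≤s; s≤s⁻¹; z<s; _≤?_; _<?_)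
open import Data.Nat.Properties
open import Data.Product using (Σ; _,_)
open import Data.Sum using (_⊎_; inj₁; inj₂)
open import Data.Vec as Vec using ([]; _∷_; lookup; toList; fromList)
open import Data.Vec.Properties using (toList∘fromList; tabulate∘lookup; tabulate-cong; ≡-dec)
open import Function using (_∘_)
open import Relation.Binary using (Rel)
open import Relation.Binary.PropositionalEquality
  using (_≡_; refl; sym; trans; cong; cong₂; subst; module ≡-Reasoning)
open import Relation.Nullary using (Dec; yes; no; ¬?)
open import Relation.Nullary.Decidable using (map′; _×-dec_; _⊎-dec_; _→-dec_)

zeros-++ : ∀ k {xs} → RunConstrained xs → RunConstrained (replicate k false ++ xs)
zeros-++ zero    r = r
zeros-++ (suc k) r = rc-zero (zeros-++ k r)

zeros : ∀ k → RunConstrained (replicate k false)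
zeros zero    = rc-nil
zeros (suc k) = rc-zero (zeros k)

RunConstrained-tail : ∀ {xs} → RunConstrained (false ∷ xs) → RunConstrained xs
RunConstrained-tail r = tail r refl
  where
  tail : ∀ {ys xs} → RunConstrained ys → ys ≡ false ∷ xs → RunConstrained xs
  tail (rc-zero r)                     refl = r
  tail (rc-block zero    _ () _ _)     _
  tail (rc-block (suc _) _ _  _ _)     ()

RunConstrained-flipHead : ∀ {xs} → RunConstrained (true ∷ xs) → RunConstrained (false ∷ xs)
RunConstrained-flipHead r = flip r refl
  where
  flip : ∀ {ys xs} → RunConstrained ys → ys ≡ true ∷ xs → RunConstrained (false ∷ xs)
  flip (rc-block zero          _ () _ _)       _
  flip (rc-block (suc zero)    j _  _ r)       refl = rc-zero (zeros-++ j r)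
  flip (rc-block (suc (suc i)) j _  i+2<j r)   refl =
    rc-zero (rc-block (suc i) j (s≤s z≤n) (<-trans (n<1+n _) i+2<j) r)
  flip (rc-zero _) ()

-- A finite automaton recognising run-constrained strings: after reading a
-- run of i ones, at least i + 1 zeros must follow before the next one.
mutual
  accepts : List Bool → Bool
  accepts []           = true
  accepts (false ∷ xs) = accepts xs
  accepts (true ∷ xs)  = afterOnes 1 xs

  afterOnes : ℕ → List Bool → Bool
  afterOnes i []           = false
  afterOnes i (true ∷ xs)  = afterOnes (suc i) xs
  afterOnes i (false ∷ xs) = zerosNeeded i xs

  zerosNeeded : ℕ → List Bool → Bool
  zerosNeeded zero    xs           = accepts xs
  zerosNeeded (suc k) []           = false
  zerosNeeded (suc k) (false ∷ xs) = zerosNeeded k xs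
  zerosNeeded (suc k) (true ∷ xs)  = false

replicate-∷ʳ : ∀ {A : Set} n (x : A) xs → replicate n x ++ (x ∷ xs) ≡ x ∷ (replicate n x ++ xs)
replicate-∷ʳ zero    x xs = refl
replicate-∷ʳ (suc n) x xs = cong (x ∷_) (replicate-∷ʳ n x xs)

mutual
  accepts-sound : ∀ xs → accepts xs ≡ true → RunConstrained xs
  accepts-sound []           _ = rc-nil
  accepts-sound (false ∷ xs) a = rc-zero (accepts-sound xs a)
  accepts-sound (true ∷ xs)  a = afterOnes-sound 0 xs a

  afterOnes-sound : ∀ i xs → afterOnes (suc i) xs ≡ true →
                    RunConstrained (replicate (suc i) true ++ xs)
  afterOnes-sound i []           ()
  afterOnes-sound i (true ∷ xs)  a =
    subst RunConstrained (sym (replicate-∷ʳ (suc i) true xs)) (afterOnes-sound (suc i) xs a)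
  afterOnes-sound i (false ∷ xs) a with zerosNeeded-sound (suc i) xs a
  ... | rest , refl , r = rc-block (suc i) (suc (suc i)) (s≤s z≤n) ≤-refl r

  zerosNeeded-sound : ∀ k xs → zerosNeeded k xs ≡ true →
                      Σ (List Bool) λ rest → xs ≡ replicate k false ++ rest × RunConstrained rest
  zerosNeeded-sound zero    xs           a = xs , refl , accepts-sound xs a
  zerosNeeded-sound (suc k) []           ()
  zerosNeeded-sound (suc k) (true ∷ xs)  ()
  zerosNeeded-sound (suc k) (false ∷ xs) a with zerosNeeded-sound k xs a
  ... | rest , refl , r = rest , refl , r

accepts-zeros : ∀ k xs → accepts (replicate k false ++ xs) ≡ accepts xs
accepts-zeros zero    xs = refl
accepts-zeros (suc k) xs = accepts-zeros k xs

afterOnes-ones : ∀ i k xs → afterOnes i (replicate k true ++ xs) ≡ afterOnes (i + k) xs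
afterOnes-ones i zero    xs = cong (λ m → afterOnes m xs) (sym (+-identityʳ i))
afterOnes-ones i (suc k) xs = trans (afterOnes-ones (suc i) k xs) (cong (λ m → afterOnes m xs) (sym (+-suc i k)))

zerosNeeded-zeros : ∀ {k m} xs → k ≤ m → zerosNeeded k (replicate m false ++ xs) ≡ accepts xs
zerosNeeded-zeros {m = m} xs z≤n       = accepts-zeros m xs
zerosNeeded-zeros         xs (s≤s k≤m) = zerosNeeded-zeros xs k≤m

accepts-complete : ∀ {xs} → RunConstrained xs → accepts xs ≡ true
accepts-complete rc-nil      = refl
accepts-complete (rc-zero r) = accepts-complete r
accepts-complete (rc-block zero    _       () _ _)
accepts-complete (rc-block (suc i) zero    _  () _)
accepts-complete (rc-block {rest} (suc i) (suc j) _ (s≤s i<j) r) = begin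
  afterOnes 1 (replicate i true ++ false ∷ replicate j false ++ rest) ≡⟨ afterOnes-ones 1 i _ ⟩
  zerosNeeded (suc i) (replicate j false ++ rest)                    ≡⟨ zerosNeeded-zeros rest i<j ⟩
  accepts rest                                                       ≡⟨ accepts-complete r ⟩
  true                                                               ∎
  where open ≡-Reasoning

runConstrained? : ∀ xs → Dec (RunConstrained xs)
runConstrained? xs = map′ (accepts-sound xs) accepts-complete (accepts xs ≟ᵇ true)

Adjacent-sym : ∀ {n u v} → Adjacent n u v → Adjacent n v u
Adjacent-sym (i , u≢v , u≡v) = i , u≢v ∘ sym , λ j j≢i → sym (u≡v j j≢i)

Adjacent-head : ∀ {n} (w : Word n) → Adjacent (suc n) (true ∷ w) (false ∷ w)
Adjacent-head w = fzero , (λ ()) , λ { fzero 0≢0 → ⊥-elim (0≢0 refl) ; (fsuc j) _ → refl }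

Adjacent-cons : ∀ {n} x {u v : Word n} → Adjacent n u v → Adjacent (suc n) (x ∷ u) (x ∷ v)
Adjacent-cons x (i , u≢v , u≡v) =
  fsuc i , u≢v , λ { fzero _ → refl ; (fsuc j) j≢i → u≡v j (j≢i ∘ cong fsuc) }

walk-++ : ∀ {n u v w k j} → Walk n u v k → Walk n v w j → Walk n u w (k + j)
walk-++ walk-here          q = q
walk-++ (walk-step pv a r) q = walk-step pv a (walk-++ r q)

walk-reverse : ∀ {n u v k} → IsVertex n u → Walk n u v k → Walk n v u k
walk-reverse pu walk-here = walk-here
walk-reverse {n} {u} {w} pu (walk-step {v = v} {k = k} pv a r) =
  subst (Walk n w u) (+-comm k 1)
    (walk-++ (walk-reverse pv r) (walk-step pu (Adjacent-sym {n} {u} {v} a) walk-here))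

walk-consFalse : ∀ {n u v k} → Walk n u v k → Walk (suc n) (false ∷ u) (false ∷ v) k
walk-consFalse walk-here          = walk-here
walk-consFalse (walk-step pv a r) = walk-step (rc-zero pv) (Adjacent-cons false a) (walk-consFalse r)

walk-to-zeros : ∀ {n} (w : Word n) → IsVertex n w →
                ∃ λ k → k ≤ n × Walk n w (Vec.replicate n false) k
walk-to-zeros []          _  = 0 , z≤n , walk-here
walk-to-zeros (false ∷ w) pw with walk-to-zeros w (RunConstrained-tail pw)
... | k , k≤n , r = k , m≤n⇒m≤1+n k≤n , walk-consFalse r
walk-to-zeros (true ∷ w)  pw with walk-to-zeros w (RunConstrained-tail (RunConstrained-flipHead pw))
... | k , k≤n , r =
  suc k , s≤s k≤n , walk-step (RunConstrained-flipHead pw) (Adjacent-head w) (walk-consFalse r)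

walk-between : ∀ {n u v} → IsVertex n u → IsVertex n v → ∃ λ k → k ≤ n + n × Walk n u v k
walk-between {u = u} {v} pu pv with walk-to-zeros u pu | walk-to-zeros v pv
... | k , k≤n , r | j , j≤n , s = k + j , +-mono-≤ k≤n j≤n , walk-++ r (walk-reverse pv s)

anyWord? : ∀ {n} {P : Word n → Set} → (∀ w → Dec (P w)) → Dec (∃ P)
anyWord? {zero} P? = map′ ([] ,_) (λ { ([] , p) → p }) (P? [])
anyWord? {suc n} {P} P? =
  map′ from to (anyWord? (P? ∘ (true ∷_)) ⊎-dec anyWord? (P? ∘ (false ∷_)))
  where
  from : (∃ (P ∘ (true ∷_))) ⊎ (∃ (P ∘ (false ∷_))) → ∃ P
  from (inj₁ (w , p)) = true ∷ w , p
  from (inj₂ (w , p)) = false ∷ w , p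
  to : ∃ P → (∃ (P ∘ (true ∷_))) ⊎ (∃ (P ∘ (false ∷_)))
  to (true ∷ w , p)  = inj₁ (w , p)
  to (false ∷ w , p) = inj₂ (w , p)

isVertex? : ∀ {n} (w : Word n) → Dec (IsVertex n w)
isVertex? w = runConstrained? (toList w ++ false ∷ false ∷ [])

adjacent? : ∀ {n} (u v : Word n) → Dec (Adjacent n u v)
adjacent? u v = any? λ i →
  ¬? (lookup u i ≟ᵇ lookup v i) ×-dec all? (λ j → ¬? (j ≟ᶠ i) →-dec (lookup u j ≟ᵇ lookup v j))

walk? : ∀ {n} k (u v : Word n) → Dec (Walk n u v k)
walk? zero u v = map′ (λ { refl → walk-here }) (λ { walk-here → refl }) (≡-dec _≟ᵇ_ u v)
walk? (suc k) u v =
  map′ (λ { (w , pw , a , r) → walk-step pw a r }) (λ { (walk-step {v = w} pw a r) → w , pw , a , r })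
       (anyWord? λ w → isVertex? w ×-dec adjacent? u w ×-dec walk? k w v)

dist? : ∀ {n} k (u v : Word n) → Dec (Dist n u v k)
dist? k u v = map′ (λ (r , shorter) → r , λ m s → ≮⇒≥ λ m<k → shorter {m} m<k s)
                   (λ (r , minimal) → r , λ {m} m<k s → <⇒≱ m<k (minimal m s))
                   (walk? k u v ×-dec allUpTo? (λ m → ¬? (walk? m u v)) k)

least-witness : ∀ {P : ℕ → Set} → (∀ m → Dec (P m)) → ∀ {K} → P K →
                ∃ λ k → P k × (∀ m → P m → k ≤ m)
least-witness P? {K} pK with P? 0
... | yes p0 = 0 , p0 , λ _ _ → z≤n
least-witness P? {zero}  pK | no ¬p0 = ⊥-elim (¬p0 pK)
least-witness P? {suc K} pK | no ¬p0 with least-witness (P? ∘ suc) pK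
... | k , pk , minimal = suc k , pk , λ { zero p → ⊥-elim (¬p0 p) ; (suc m) p → s≤s (minimal m p) }

greatest-witness : ∀ {P : ℕ → Set} → (∀ m → Dec (P m)) → ∀ N → P 0 →
                   ∃ λ d → P d × (∀ m → m ≤ N → P m → m ≤ d)
greatest-witness P? zero    p0 = 0 , p0 , λ _ m≤0 _ → m≤0
greatest-witness {P} P? (suc N) p0 with P? (suc N)
... | yes pN = suc N , pN , λ _ m≤N _ → m≤N
... | no ¬pN with greatest-witness P? N p0
... | d , pd , maximal = d , pd , below
  where
  below : ∀ m → m ≤ suc N → P m → m ≤ d
  below m m≤ pm with m≤n⇒m<n∨m≡n m≤
  ... | inj₁ m<suc = maximal m (s≤s⁻¹ m<suc) pm
  ... | inj₂ refl  = ⊥-elim (¬pN pm)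

dist-exists : ∀ {n u v} → IsVertex n u → IsVertex n v → ∃ λ k → k ≤ n + n × Dist n u v k
dist-exists {u = u} {v} pu pv with walk-between pu pv
... | K , K≤ , r with least-witness (λ m → walk? m u v) r
... | k , rk , minimal = k , ≤-trans (minimal K r) K≤ , rk , minimal

zeros-isVertex : ∀ n → IsVertex n (Vec.replicate n false)
zeros-isVertex zero    = rc-zero (rc-zero rc-nil)
zeros-isVertex (suc n) = rc-zero (zeros-isVertex n)

-- Distances are bounded by 2n, so the diameter is the largest realised
-- distance up to 2n.
diameter : ∀ n → ∃ (IsDiameter n)
diameter n with greatest-witness realised? (n + n) (0ⁿ , 0ⁿ , p0ⁿ , p0ⁿ , walk-here , λ _ _ → z≤n)
  where
  0ⁿ : Word n
  0ⁿ = Vec.replicate n false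
  p0ⁿ : IsVertex n 0ⁿ
  p0ⁿ = zeros-isVertex n
  realised? : ∀ d → Dec (∃ λ u → ∃ λ v → IsVertex n u × IsVertex n v × Dist n u v d)
  realised? d = anyWord? λ u → anyWord? λ v → isVertex? u ×-dec isVertex? v ×-dec dist? d u v
... | d , realised , maximal = d , realised , bounded
  where
  bounded : ∀ u v → IsVertex n u → IsVertex n v → ∃ λ k → Dist n u v k × k ≤ d
  bounded u v pu pv with dist-exists pu pv
  ... | k , k≤ , dk = k , dk , maximal k k≤ (u , v , pu , pv , dk)

hamming : List Bool → List Bool → ℕ
hamming (x ∷ xs) (y ∷ ys) = (if x xor y then 1 else 0) + hamming xs ys
hamming _        _        = 0

hamming-self : ∀ xs → hamming xs xs ≡ 0
hamming-self []           = refl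
hamming-self (true ∷ xs)  = hamming-self xs
hamming-self (false ∷ xs) = hamming-self xs

Vec-ext : ∀ {n} {u v : Word n} → (∀ i → lookup u i ≡ lookup v i) → u ≡ v
Vec-ext {u = u} {v} eq = trans (sym (tabulate∘lookup u)) (trans (tabulate-cong eq) (tabulate∘lookup v))

hamming-adjacent : ∀ {n} (u v w : Word n) → Adjacent n u v →
                   hamming (toList u) (toList w) ≤ suc (hamming (toList v) (toList w))
hamming-adjacent (x ∷ u) (y ∷ v) (z ∷ w) (fzero , _ , u≡v)
  rewrite Vec-ext {u = u} {v} (λ j → u≡v (fsuc j) λ ()) =
  ≤-trans (+-monoˡ-≤ (hamming (toList v) (toList w)) (mismatch≤1 x z)) (s≤s (m≤n+m _ _))
  where
  mismatch≤1 : ∀ x z → (if x xor z then 1 else 0) ≤ 1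
  mismatch≤1 true  true  = z≤n
  mismatch≤1 true  false = ≤-refl
  mismatch≤1 false true  = ≤-refl
  mismatch≤1 false false = z≤n
hamming-adjacent (x ∷ u) (y ∷ v) (z ∷ w) (fsuc i , u≢v , u≡v)
  rewrite u≡v fzero (λ ()) =
  ≤-trans (+-monoʳ-≤ (if y xor z then 1 else 0)
                     (hamming-adjacent u v w (i , u≢v , λ j j≢i → u≡v (fsuc j) (j≢i ∘ fsuc-injective))))
          (≤-reflexive (+-suc _ _))

walk-hamming : ∀ {n u v k} → Walk n u v k → hamming (toList u) (toList v) ≤ k
walk-hamming {u = u} walk-here = ≤-reflexive (hamming-self (toList u))
walk-hamming {u = u} {w} (walk-step {v = v} _ a r) =
  ≤-trans (hamming-adjacent u v w a) (s≤s (walk-hamming r))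

hamming≤diameter : ∀ {n d u v} → IsDiameter n d → IsVertex n u → IsVertex n v →
                   hamming (toList u) (toList v) ≤ d
hamming≤diameter (_ , bounded) pu pv with bounded _ _ pu pv
... | k , (r , _) , k≤d = ≤-trans (walk-hamming r) k≤d

alternating : Bool → List ℕ → List Bool → List Bool
alternating b []      xs = xs
alternating b (l ∷ L) xs = replicate l b ++ alternating (not b) L xs

alternating-++ : ∀ b L xs ys → alternating b L xs ++ ys ≡ alternating b L (xs ++ ys)
alternating-++ b []      xs ys = refl
alternating-++ b (l ∷ L) xs ys =
  trans (++-assoc (replicate l b) _ ys) (cong (replicate l b ++_) (alternating-++ (not b) L xs ys))

length-alternating : ∀ b L xs → length (alternating b L xs) ≡ sum L + length xs
length-alternating b []      xs = refl
length-alternating b (l ∷ L) xs = begin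
  length (replicate l b ++ alternating (not b) L xs)
    ≡⟨ length-++ (replicate l b) ⟩
  length (replicate l b) + length (alternating (not b) L xs)
    ≡⟨ cong₂ _+_ (length-replicate l) (length-alternating (not b) L xs) ⟩
  l + (sum L + length xs)
    ≡⟨ +-assoc l (sum L) _ ⟨
  l + sum L + length xs
    ∎
  where open ≡-Reasoning

hamming-alternating : ∀ b L xs → hamming (alternating b L xs) (alternating (not b) L xs) ≡ sum L
hamming-alternating b []      xs = hamming-self xs
hamming-alternating b (l ∷ L) xs =
  trans (hamming-complement b l) (cong (l +_) (hamming-alternating (not b) L xs))
  where
  hamming-complement : ∀ b l {ys zs} →
    hamming (replicate l b ++ ys) (replicate l (not b) ++ zs) ≡ l + hamming ys zs
  hamming-complement b     zero    = refl
  hamming-complement true  (suc l) = cong suc (hamming-complement true l)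
  hamming-complement false (suc l) = cong suc (hamming-complement false l)

alternating-runConstrained : ∀ b L {B} → Linked _<_ (L ∷ʳ B) →
                             RunConstrained (alternating b L (replicate B false))
alternating-runConstrained b     []                {B} _  = zeros B
alternating-runConstrained false (l ∷ L)           lk =
  zeros-++ l (alternating-runConstrained true L (Linked.tail lk))
alternating-runConstrained true  (zero ∷ L)        lk =
  alternating-runConstrained false L (Linked.tail lk)
alternating-runConstrained true  (suc l ∷ [])      {B} (l<B ∷ [-]) =
  subst (λ zs → RunConstrained (replicate (suc l) true ++ zs)) (++-identityʳ (replicate B false))
    (rc-block (suc l) B (s≤s z≤n) l<B rc-nil)
alternating-runConstrained true  (suc l ∷ l′ ∷ L) (l<l′ ∷ lk) =
  rc-block (suc l) l′ (s≤s z≤n) l<l′ (alternating-runConstrained true L (Linked.tail lk))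

triangular : ℕ → ℕ
triangular zero    = 0
triangular (suc m) = suc m + triangular m

n≤triangular : ∀ m → m ≤ triangular m
n≤triangular zero    = z≤n
n≤triangular (suc m) = m≤m+n (suc m) (triangular m)

2*triangular : ∀ m → 2 * triangular m ≡ m * suc m
2*triangular zero    = refl
2*triangular (suc m) = begin
  2 * (suc m + triangular m)     ≡⟨ *-distribˡ-+ 2 (suc m) (triangular m) ⟩
  2 * suc m + 2 * triangular m   ≡⟨ cong (2 * suc m +_) (2*triangular m) ⟩
  2 * suc m + m * suc m          ≡⟨ *-distribʳ-+ (suc m) 2 m ⟨
  suc (suc m) * suc m            ≡⟨ *-comm (suc (suc m)) (suc m) ⟩
  suc m * suc (suc m)            ∎
  where open ≡-Reasoning

Linked-∷ʳ⁺ : ∀ {a ℓ} {A : Set a} {R : Rel A ℓ} {x y} xs →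
             Linked R (xs ∷ʳ x) → R x y → Linked R (xs ∷ʳ x ∷ʳ y)
Linked-∷ʳ⁺ []           [-]      Rxy = Rxy ∷ [-]
Linked-∷ʳ⁺ (a ∷ [])     (r ∷ rs) Rxy = r ∷ Linked-∷ʳ⁺ [] rs Rxy
Linked-∷ʳ⁺ (a ∷ b ∷ xs) (r ∷ rs) Rxy = r ∷ Linked-∷ʳ⁺ (b ∷ xs) rs Rxy

-- The part m is used exactly when S does not fit into 1, …, m − 1.
distinctParts : ∀ m {S B} → S ≤ triangular m → m < B →
                ∃ λ L → sum L ≡ S × Linked _<_ (L ∷ʳ B)
distinctParts zero    {zero} _  _   = [] , refl , [-]
distinctParts (suc m) {S}    S≤ m<B with S ≤? triangular m
... | yes S≤T = distinctParts m S≤T (<-trans (n<1+n m) m<B)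
... | no  S≰T with distinctParts m {S ∸ suc m} (m≤n+o⇒m∸n≤o S (suc m) S≤) (n<1+n m)
... | L , sumL , lk = L ∷ʳ suc m , sum-L∷ʳm , Linked-∷ʳ⁺ L lk m<B
  where
  m<S : m < S
  m<S = ≤-<-trans (n≤triangular m) (≰⇒> S≰T)
  sum-L∷ʳm : sum (L ∷ʳ suc m) ≡ S
  sum-L∷ʳm = begin
    sum (L ++ suc m ∷ [])  ≡⟨ sum-++ L (suc m ∷ []) ⟩
    sum L + (suc m + 0)    ≡⟨ cong₂ _+_ sumL (+-identityʳ (suc m)) ⟩
    S ∸ suc m + suc m      ≡⟨ m∸n+n≡m m<S ⟩
    S                      ∎
    where open ≡-Reasoning

record Layout (n : ℕ) : Set where
  field
    blocks padding    : ℕ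
    n≡blocks+padding  : n ≡ blocks + padding
    blocks≤triangular : blocks ≤ triangular (suc padding)
    padding²<2n       : padding * padding < 2 * n

square<2*[triangular+1] : ∀ t → suc t * suc t < 2 * suc (triangular (suc t) + t)
square<2*[triangular+1] t = begin-strict
  suc t * suc t                             ≤⟨ *-monoʳ-≤ (suc t) (n≤1+n (suc t)) ⟩
  suc t * suc (suc t)                       <⟨ m<m+n _ z<s ⟩
  suc t * suc (suc t) + 2 * suc t           ≡⟨ cong (_+ 2 * suc t) (2*triangular (suc t)) ⟨
  2 * triangular (suc t) + 2 * suc t        ≡⟨ *-distribˡ-+ 2 (triangular (suc t)) (suc t) ⟨
  2 * (triangular (suc t) + suc t)          ≡⟨ cong (2 *_) (+-suc (triangular (suc t)) t) ⟩
  2 * suc (triangular (suc t) + t)          ∎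
  where open ≤-Reasoning

-- Fill the blocks until they reach triangular (padding + 1), then grow the padding.
Layout-suc : ∀ {n} → Layout n → Layout (suc n)
Layout-suc {n} record { blocks = S ; padding = t ; n≡blocks+padding = n≡S+t
                      ; blocks≤triangular = S≤T ; padding²<2n = t²<2n }
  with S <? triangular (suc t)
... | yes S<T = record
  { blocks = suc S ; padding = t ; n≡blocks+padding = cong suc n≡S+t
  ; blocks≤triangular = S<T ; padding²<2n = <-≤-trans t²<2n (*-monoʳ-≤ 2 (n≤1+n n)) }
... | no S≮T with ≤-antisym S≤T (≮⇒≥ S≮T)
... | refl = record
  { blocks = S ; padding = suc t ; n≡blocks+padding = trans (cong suc n≡S+t) (sym (+-suc S t))
  ; blocks≤triangular = m≤n+m S (suc (suc t))
  ; padding²<2n = subst (λ m → suc t * suc t < 2 * suc m) (sym n≡S+t) (square<2*[triangular+1] t) }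

layout : ∀ {n} → 1 ≤ n → Layout n
layout {suc zero}    _ = record
  { blocks = 1 ; padding = 0 ; n≡blocks+padding = refl ; blocks≤triangular = ≤-refl ; padding²<2n = z<s }
layout {suc (suc n)} _ = Layout-suc (layout {suc n} (s≤s z≤n))

ofList : ∀ {n} (xs : List Bool) → length xs ≡ n → Word n
ofList xs refl = fromList xs

toList-ofList : ∀ {n} xs (e : length xs ≡ n) → toList (ofList xs e) ≡ xs
toList-ofList xs refl = toList∘fromList xs

replicate-+ : ∀ {A : Set} m n (x : A) → replicate m x ++ replicate n x ≡ replicate (m + n) x
replicate-+ zero    n x = refl
replicate-+ (suc m) n x = cong (x ∷_) (replicate-+ m n x)

alternating-vertices : ∀ {n t} L → Linked _<_ (L ∷ʳ (2 + t)) → n ≡ sum L + t →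
  ∃ λ u → ∃ λ v → IsVertex n u × IsVertex n v × hamming (toList u) (toList v) ≡ sum L
alternating-vertices {n} {t} L increasing n≡L+t =
  word true , word false , word-isVertex true , word-isVertex false , hamming-words
  where
  open ≡-Reasoning
  padded : Bool → List Bool
  padded b = alternating b L (replicate t false)

  length-padded : ∀ b → length (padded b) ≡ n
  length-padded b = begin
    length (padded b)                  ≡⟨ length-alternating b L (replicate t false) ⟩
    sum L + length (replicate t false) ≡⟨ cong (sum L +_) (length-replicate t) ⟩
    sum L + t                          ≡⟨ n≡L+t ⟨
    n                                  ∎

  word : Bool → Word n
  word b = ofList (padded b) (length-padded b)

  toList-word : ∀ b → toList (word b) ≡ padded b
  toList-word b = toList-ofList (padded b) (length-padded b)

  word-isVertex : ∀ b → IsVertex n (word b)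
  word-isVertex b = subst RunConstrained (sym word00) (alternating-runConstrained b L increasing)
    where
    word00 : toList (word b) ++ false ∷ false ∷ [] ≡ alternating b L (replicate (2 + t) false)
    word00 = begin
      toList (word b) ++ false ∷ false ∷ []
        ≡⟨ cong (_++ false ∷ false ∷ []) (toList-word b) ⟩
      padded b ++ replicate 2 false
        ≡⟨ alternating-++ b L (replicate t false) (replicate 2 false) ⟩
      alternating b L (replicate t false ++ replicate 2 false)
        ≡⟨ cong (alternating b L) (replicate-+ t 2 false) ⟩
      alternating b L (replicate (t + 2) false)
        ≡⟨ cong (λ k → alternating b L (replicate k false)) (+-comm t 2) ⟩
      alternating b L (replicate (2 + t) false)
        ∎

  hamming-words : hamming (toList (word true)) (toList (word false)) ≡ sum L
  hamming-words = trans (cong₂ hamming (toList-word true) (toList-word false))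
                        (hamming-alternating true L (replicate t false))

theorem5p3 : (n : ℕ) → 1 ≤ n →
    ∃ λ d → IsDiameter n d × ((n ∸ d) * (n ∸ d) < 2 * n)
theorem5p3 n 1≤n with diameter n | layout 1≤n
... | d , isDiameter
    | record { padding = t ; n≡blocks+padding = n≡S+t
             ; blocks≤triangular = S≤T ; padding²<2n = t²<2n }
  with distinctParts (suc t) S≤T ≤-refl
... | L , refl , increasing with alternating-vertices L increasing n≡S+t
... | u , v , pu , pv , hamming≡S = d , isDiameter , ≤-<-trans (*-mono-≤ n∸d≤t n∸d≤t) t²<2n
  where
  S≤d : sum L ≤ d
  S≤d = subst (_≤ d) hamming≡S (hamming≤diameter isDiameter pu pv)

  n∸d≤t : n ∸ d ≤ t
  n∸d≤t = m≤n+o⇒m∸n≤o n d (≤-trans (≤-reflexive n≡S+t) (+-monoˡ-≤ t S≤d))
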